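{- For every even natural number $n \geq 8$, the upper orientable twin domination number of the complete graph $K_n$ satisfies $DOM^{*}(K_n) \leq \frac{n}{2}$.
   Context: Let $D=(V,A)$ be a digraph. A subset $S \subseteq V$ is a twin dominating set of $D$ if for every vertex $v \in V - S$ there exist vertices $u_1, u_2 \in S$ (possibly equal) such that $(v,u_1)$ and $(u_2,v)$ are arcs of $D$. The twin domination number $\gamma^{*}(D)$ is the minimum cardinality of a twin dominating set of $D$. For a graph $G$, the upper orientable twin domination number is $DOM^{*}(G)=\max\{\gamma^{*}(D) : D \text{ is an orientation of } G\}$. An orientation of $K_n$ is a tournament on $n$ vertices. -}

module Defs where

open import Data.Nat using (ℕ; _≤_; _/_)
open import Data.Bool using (Bool; true; false)
open import Data.Fin using (Fin)
open import Data.Fin.Subset using (Subset; _∈_; _∉_; ∣_∣)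
open import Data.Product using (Σ; ∃; _×_; _,_)
open import Relation.Binary.PropositionalEquality using (_≡_; _≢_)
open import Relation.Nullary using (¬_)

Digraph : ℕ → Set
Digraph n = Fin n → Fin n → Bool

-- An orientation of the complete graph K_n (a tournament on n vertices):
-- no loops, and for each pair of distinct vertices exactly one of the two arcs.
record IsTournament {n : ℕ} (D : Digraph n) : Set where
  field
    irreflexive : ∀ v → D v v ≡ false
    total       : ∀ u v → u ≢ v → D u v ≡ true → D v u ≡ false
    complete    : ∀ u v → u ≢ v → D u v ≡ false → D v u ≡ true

IsTwinDominating : {n : ℕ} → Digraph n → Subset n → Set
IsTwinDominating {n} D S =
  ∀ v → v ∉ S →
    (∃ λ u₁ → u₁ ∈ S × D v u₁ ≡ true) × (∃ λ u₂ → u₂ ∈ S × D u₂ v ≡ true)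

TwinDomNumber≤ : {n : ℕ} → Digraph n → ℕ → Set
TwinDomNumber≤ {n} D k = ∃ λ (S : Subset n) → IsTwinDominating D S × ∣ S ∣ ≤ k

UpperOrientableTwinDomKn≤ : ℕ → ℕ → Set
UpperOrientableTwinDomKn≤ n k = (D : Digraph n) → IsTournament D → TwinDomNumber≤ D k

module Submission where

-- We work with the sub-tournaments induced by duplicate-free lists of
-- vertices and argue by induction on n = 8 + 2j.
-- * Counting: a tournament on m vertices has m(m-1)/2 arcs, so some vertex
--   has out-degree at most (m-1)/2.  Picking such vertices greedily, any
--   2^(k+1) - 2 vertices are absorbed by k of them (every other vertex has
--   an out-neighbour among them); applied to the converse tournament, the
--   same holds for dominating (in-neighbours).
-- * n = 8: take a vertex v of in-degree i ≤ 3.  For i ≤ 2, v together with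
--   a dominating set of its in-neighbours and an absorbing set of its
--   out-neighbours has at most 4 vertices; for i = 3 a case analysis of the
--   arcs between in- and out-neighbours of v does it.
-- * n → n + 2: given a directed triangle a ⇒ b ⇒ c ⇒ a, twin dominate the
--   tournament without a and b and add one of a, b, c; without triangles
--   the tournament is transitive and its source and sink suffice.

open import Defs
open import Data.Nat using (ℕ; _≤_; _/_)
open import Data.Nat.Divisibility using (_∣_)

open import Data.Bool.Base using (true; false)
import Data.Bool.Properties as Bool
open import Data.Fin.Base using (Fin)
import Data.Fin.Properties as Fin
open import Data.Fin.Subset using (Subset; ∣_∣)
import Data.Fin.Subset as Sub
open import Data.Fin.Subset.Properties using (x∈p∪q⁺; x∈⁅x⁆; ∣⊥∣≡0; ∣⁅x⁆∣≡1)
open import Data.List.Base using (List; []; _∷_; _++_; length; filter; allFin)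
open import Data.List.Properties
  using (filter-accept; filter-reject; filter-all; filter-some; length-filter; length-++; length-tabulate)
open import Data.List.Membership.Propositional using (_∈_; _∉_; find; lose)
open import Data.List.Membership.Propositional.Properties
  using (∈-filter⁺; ∈-filter⁻; ∈-++⁺ˡ; ∈-++⁺ʳ; ∈-++⁻; ∈-allFin)
open import Data.List.Relation.Binary.Subset.Propositional using (_⊆_)
open import Data.List.Relation.Binary.Subset.Propositional.Properties
  using (⊆-trans; ∈-∷⁺ʳ; ∷⁺ʳ; filter-⊆; xs⊆xs++ys; xs⊆ys++xs)
open import Data.List.Relation.Unary.All as All using (All; []; _∷_)
open import Data.List.Relation.Unary.All.Properties using (¬Any⇒All¬)
open import Data.List.Relation.Unary.Any using (here; there; any?)
open import Data.List.Relation.Unary.Unique.Propositional using (Unique; []; _∷_)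
open import Data.List.Relation.Unary.Unique.Propositional.Properties using (filter⁺; allFin⁺)
open import Data.Nat.Base using (zero; suc; _+_; _*_; _∸_; _<_; z≤n; s≤s)
open import Data.Nat.Divisibility using (divides)
open import Data.Nat.DivMod using (m*n/n≡m)
open import Data.Nat.Properties
open import Data.Nat.Tactic.RingSolver using (solve-∀)
open import Data.Product.Base using (∃; _×_; _,_; proj₁; proj₂)
open import Data.Sum.Base using (_⊎_; inj₁; inj₂; swap; [_,_]′)
open import Data.Vec.Base using ([]; _∷_)
open import Function.Base using (_∘_; id)
open import Relation.Binary.Definitions using (DecidableEquality)
open import Relation.Binary.PropositionalEquality
open import Relation.Nullary using (¬_; ¬?; Dec; yes; no; contradiction; _×-dec_; map′)
open import Relation.Unary using (Decidable)

module ListFacts {A : Set} where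

  some-member : ∀ {xs : List A} → 0 < length xs → ∃ (_∈ xs)
  some-member {x ∷ _} _ = x , here refl

  ++-⊆ : ∀ {xs ys zs : List A} → xs ⊆ zs → ys ⊆ zs → xs ++ ys ⊆ zs
  ++-⊆ {xs} xs⊆zs ys⊆zs = [ xs⊆zs , ys⊆zs ]′ ∘ ∈-++⁻ xs

  sumOver : (A → ℕ) → List A → ℕ
  sumOver f []       = 0
  sumOver f (x ∷ xs) = f x + sumOver f xs

  double-sumOver-≥ : ∀ {k} (f : A → ℕ) xs → All (λ x → k ≤ 2 * f x) xs →
                     length xs * k ≤ 2 * sumOver f xs
  double-sumOver-≥ f []       []         = z≤n
  double-sumOver-≥ f (x ∷ xs) (k≤ ∷ k≤s) = begin
    _ + length xs * _           ≤⟨ +-mono-≤ k≤ (double-sumOver-≥ f xs k≤s) ⟩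
    2 * f x + 2 * sumOver f xs  ≡⟨ *-distribˡ-+ 2 (f x) (sumOver f xs) ⟨
    2 * sumOver f (x ∷ xs)      ∎
    where open ≤-Reasoning

  module _ {P Q : A → Set} (P? : Decidable P) (Q? : Decidable Q)
           (exclusive : ∀ {u} → P u → ¬ Q u) where

    lengths-cons-P : ∀ {x xs} → P x →
      length (filter P? (x ∷ xs)) + length (filter Q? (x ∷ xs)) ≡
      suc (length (filter P? xs) + length (filter Q? xs))
    lengths-cons-P px = cong₂ (λ ps qs → length ps + length qs)
                          (filter-accept P? px) (filter-reject Q? (exclusive px))

    lengths-cons-Q : ∀ {x xs} → Q x →
      length (filter P? (x ∷ xs)) + length (filter Q? (x ∷ xs)) ≡
      length (filter P? xs) + suc (length (filter Q? xs))
    lengths-cons-Q qx = cong₂ (λ ps qs → length ps + length qs)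
                          (filter-reject P? (λ px → exclusive px qx)) (filter-accept Q? qx)

    length-filter-split : ∀ xs → (∀ {u} → u ∈ xs → P u ⊎ Q u) →
                          length (filter P? xs) + length (filter Q? xs) ≡ length xs
    length-filter-split []       covers = refl
    length-filter-split (x ∷ xs) covers
      with ih ← length-filter-split xs (covers ∘ there) | covers (here refl)
    ... | inj₁ px = trans (lengths-cons-P px) (cong suc ih)
    ... | inj₂ qx = trans (lengths-cons-Q qx) (trans (+-suc _ _) (cong suc ih))

    length-filter-split-except : ∀ {v} xs → Unique xs → v ∈ xs → ¬ P v → ¬ Q v →
      (∀ {u} → u ∈ xs → u ≢ v → P u ⊎ Q u) →
      suc (length (filter P? xs) + length (filter Q? xs)) ≡ length xs
    length-filter-split-except (x ∷ xs) (x∉xs ∷ _) (here refl) ¬px ¬qx covers =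
      cong suc (trans (cong₂ (λ ps qs → length ps + length qs)
                             (filter-reject P? ¬px) (filter-reject Q? ¬qx))
                      (length-filter-split xs λ u∈xs →
                         covers (there u∈xs) (≢-sym (All.lookup x∉xs u∈xs))))
    length-filter-split-except (x ∷ xs) (x∉xs ∷ uniq) (there v∈xs) ¬pv ¬qv covers
      with ih ← length-filter-split-except xs uniq v∈xs ¬pv ¬qv (covers ∘ there)
         | covers (here refl) (All.lookup x∉xs v∈xs)
    ... | inj₁ px = trans (cong suc (lengths-cons-P px)) (cong suc ih)
    ... | inj₂ qx = trans (cong suc (lengths-cons-Q qx)) (cong suc (trans (+-suc _ _) ih))

module Removal {A : Set} (_≟_ : DecidableEquality A) where

  open ListFacts

  remove : A → List A → List A
  remove v = filter (λ u → ¬? (u ≟ v))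

  ∈-remove⁺ : ∀ {u v xs} → u ∈ xs → u ≢ v → u ∈ remove v xs
  ∈-remove⁺ = ∈-filter⁺ _

  ∈-remove⁻ : ∀ {u v xs} → u ∈ remove v xs → u ∈ xs × u ≢ v
  ∈-remove⁻ = ∈-filter⁻ _

  remove-⊆ : ∀ {v xs} → remove v xs ⊆ xs
  remove-⊆ = filter-⊆ _ _

  remove-unique : ∀ {v xs} → Unique xs → Unique (remove v xs)
  remove-unique = filter⁺ _

  length-remove : ∀ {v xs} → Unique xs → v ∈ xs → suc (length (remove v xs)) ≡ length xs
  length-remove {v} {v ∷ xs} (v∉xs ∷ _) (here refl) = cong (suc ∘ length) (begin
    remove v (v ∷ xs) ≡⟨ filter-reject (λ u → ¬? (u ≟ v)) (λ v≢v → v≢v refl) ⟩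
    remove v xs       ≡⟨ filter-all (λ u → ¬? (u ≟ v)) (All.map ≢-sym v∉xs) ⟩
    xs                ∎)
    where open ≡-Reasoning
  length-remove {v} (x∉xs ∷ uniq) (there v∈xs) =
    trans (cong (suc ∘ length) (filter-accept (λ u → ¬? (u ≟ v)) (All.lookup x∉xs v∈xs)))
          (cong suc (length-remove uniq v∈xs))

  another-member : ∀ {v xs} → Unique xs → v ∈ xs → 1 < length xs → ∃ (_∈ remove v xs)
  another-member uniq v∈xs 1<|xs| =
    some-member (≤-pred (subst (1 <_) (sym (length-remove uniq v∈xs)) 1<|xs|))

record Tournament (A : Set) : Set₁ where
  field
    _⇒_     : A → A → Set
    _⇒?_    : ∀ u v → Dec (u ⇒ v)
    ⇒-asym  : ∀ {u v} → u ⇒ v → ¬ v ⇒ u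
    ⇒-total : ∀ {u v} → u ≢ v → u ⇒ v ⊎ v ⇒ u

-- The converse tournament, with every arc reversed; in-neighbourhood
-- statements are obtained from out-neighbourhood ones by passing to it.
converse : ∀ {A} → Tournament A → Tournament A
converse T = record
  { _⇒_     = λ u v → v ⇒ u
  ; _⇒?_    = λ u v → v ⇒? u
  ; ⇒-asym  = ⇒-asym
  ; ⇒-total = λ u≢v → swap (⇒-total u≢v)
  }
  where open Tournament T

module TournamentTheory {A : Set} (_≟_ : DecidableEquality A) (T : Tournament A) where

  open Tournament T public
  open ListFacts
  open Removal _≟_
  open import Data.List.Membership.DecPropositional _≟_ using (_∈?_)

  ⇒-irrefl : ∀ {v} → ¬ v ⇒ v
  ⇒-irrefl v⇒v = ⇒-asym v⇒v v⇒v

  ⇒-distinct : ∀ {u v} → u ⇒ v → u ≢ v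
  ⇒-distinct u⇒v refl = ⇒-irrefl u⇒v

  ⇒-flip : ∀ {u v} → u ≢ v → ¬ u ⇒ v → v ⇒ u
  ⇒-flip u≢v ¬u⇒v with ⇒-total u≢v
  ... | inj₁ u⇒v = contradiction u⇒v ¬u⇒v
  ... | inj₂ v⇒u = v⇒u

  Out In : A → List A → List A
  Out v xs = filter (v ⇒?_) xs
  In  v xs = filter (_⇒? v) xs

  out+in : ∀ {v} xs → Unique xs → v ∈ xs →
           suc (length (Out v xs) + length (In v xs)) ≡ length xs
  out+in xs uniq v∈xs = length-filter-split-except (_ ⇒?_) (_⇒? _) ⇒-asym
    xs uniq v∈xs ⇒-irrefl ⇒-irrefl (λ _ u≢v → ⇒-total (≢-sym u≢v))

  ∈-Out⁻ : ∀ {v x xs} → x ∈ Out v xs → x ∈ xs × v ⇒ x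
  ∈-Out⁻ = ∈-filter⁻ (_ ⇒?_)

  ∈-In⁻ : ∀ {v x xs} → x ∈ In v xs → x ∈ xs × x ⇒ v
  ∈-In⁻ = ∈-filter⁻ (_⇒? _)

  neighbour : ∀ {v x xs} → x ∈ xs → x ≢ v → x ∈ In v xs ⊎ x ∈ Out v xs
  neighbour x∈xs x≢v with ⇒-total x≢v
  ... | inj₁ x⇒v = inj₁ (∈-filter⁺ _ x∈xs x⇒v)
  ... | inj₂ v⇒x = inj₂ (∈-filter⁺ _ x∈xs v⇒x)

  arcs : List A → ℕ
  arcs xs = sumOver (λ x → length (Out x xs)) xs

  sumOver-out-cons : ∀ x ys zs →
    sumOver (λ z → length (Out z (x ∷ ys))) zs ≡
    sumOver (λ z → length (Out z ys)) zs + length (In x zs)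
  sumOver-out-cons x ys []       = sym (+-identityʳ _)
  sumOver-out-cons x ys (z ∷ zs) with ih ← sumOver-out-cons x ys zs | z ⇒? x
  ... | yes _ = trans (cong (suc o +_) ih) (regroup o (sumOver (λ z → length (Out z ys)) zs) i)
    where
      o = length (Out z ys)
      i = length (In x zs)
      regroup : ∀ o s i → suc o + (s + i) ≡ o + s + suc i
      regroup = solve-∀
  ... | no _  = trans (cong (o +_) ih) (sym (+-assoc o (sumOver (λ z → length (Out z ys)) zs) i))
    where
      o = length (Out z ys)
      i = length (In x zs)

  arcs-cons : ∀ {x ys} → All (x ≢_) ys → arcs (x ∷ ys) ≡ arcs ys + length ys
  arcs-cons {x} {ys} x∉ys = begin
    length (Out x (x ∷ ys)) + sumOver (λ z → length (Out z (x ∷ ys))) ys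
      ≡⟨ cong₂ _+_ (cong length (filter-reject (x ⇒?_) ⇒-irrefl)) (sumOver-out-cons x ys ys) ⟩
    length (Out x ys) + (arcs ys + length (In x ys))
      ≡⟨ regroup (length (Out x ys)) (arcs ys) (length (In x ys)) ⟩
    arcs ys + (length (Out x ys) + length (In x ys))
      ≡⟨ cong (arcs ys +_) (length-filter-split (x ⇒?_) (_⇒? x) ⇒-asym ys
                             (λ u∈ys → ⇒-total (All.lookup x∉ys u∈ys))) ⟩
    arcs ys + length ys ∎
    where
      open ≡-Reasoning
      regroup : ∀ o a i → o + (a + i) ≡ a + (o + i)
      regroup = solve-∀

  arcs-formula : ∀ xs → Unique xs → 2 * arcs xs + length xs ≡ length xs * length xs
  arcs-formula []       []              = refl
  arcs-formula (x ∷ xs) (x∉xs ∷ uniq) = begin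
    2 * arcs (x ∷ xs) + suc m   ≡⟨ cong (λ a → 2 * a + suc m) (arcs-cons x∉xs) ⟩
    2 * (arcs xs + m) + suc m   ≡⟨ regroup (arcs xs) m ⟩
    2 * arcs xs + m + 2 * m + 1 ≡⟨ cong (λ a → a + 2 * m + 1) (arcs-formula xs uniq) ⟩
    m * m + 2 * m + 1           ≡⟨ square m ⟩
    suc m * suc m               ∎
    where
      open ≡-Reasoning
      m = length xs
      regroup : ∀ a m → 2 * (a + m) + suc m ≡ 2 * a + m + 2 * m + 1
      regroup = solve-∀
      square : ∀ m → m * m + 2 * m + 1 ≡ suc m * suc m
      square = solve-∀

  -- Some vertex has out-degree at most (m-1)/2: otherwise there would be
  -- at least m²/2 arcs.
  low-outdegree : ∀ xs → Unique xs → 0 < length xs →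
                  ∃ λ z → z ∈ xs × 2 * length (Out z xs) < length xs
  low-outdegree xs uniq nonempty
    with any? (λ z → 2 * length (Out z xs) <? length xs) xs
  ... | yes low = find low
  ... | no none = contradiction too-many-arcs (<⇒≱ (m<m+n _ nonempty))
    where
      m = length xs
      high : All (λ z → m ≤ 2 * length (Out z xs)) xs
      high = All.map ≮⇒≥ (¬Any⇒All¬ xs none)
      too-many-arcs : m * m + m ≤ m * m
      too-many-arcs = begin
        m * m + m          ≤⟨ +-monoˡ-≤ m (double-sumOver-≥ _ xs high) ⟩
        2 * arcs xs + m    ≡⟨ arcs-formula xs uniq ⟩
        m * m              ∎
        where open ≤-Reasoning

  _⇒∃_ : A → List A → Set
  x ⇒∃ S = ∃ λ u → u ∈ S × x ⇒ u

  ⇒∃-mono : ∀ {x S S′} → S ⊆ S′ → x ⇒∃ S → x ⇒∃ S′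
  ⇒∃-mono S⊆S′ (u , u∈S , x⇒u) = u , S⊆S′ u∈S , x⇒u

  _⇒∃?_ : ∀ x S → Dec (x ⇒∃ S)
  x ⇒∃? S = map′ find (λ (_ , u∈S , x⇒u) → lose u∈S x⇒u) (any? (x ⇒?_) S)

  _Absorbs_ : List A → List A → Set
  B Absorbs xs = ∀ {x} → x ∈ xs → x ∉ B → x ⇒∃ B

  Absorbs-mono : ∀ {B B′ xs} → B ⊆ B′ → B Absorbs xs → B′ Absorbs xs
  Absorbs-mono B⊆B′ absorbs x∈xs x∉B′ = ⇒∃-mono B⊆B′ (absorbs x∈xs (x∉B′ ∘ B⊆B′))

  absorb-except : ∀ {b z B xs} → z ⇒ b → B Absorbs remove z xs → (b ∷ B) Absorbs xs
  absorb-except {z = z} z⇒b absorbs {x} x∈xs x∉b∷B with x ≟ z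
  ... | yes refl = _ , here refl , z⇒b
  ... | no  x≢z  = ⇒∃-mono there (absorbs (∈-remove⁺ x∈xs x≢z) (x∉b∷B ∘ there))

  absorbing-nonempty : ∀ {B xs x} → B Absorbs xs → x ∈ xs → ∃ (_∈ B)
  absorbing-nonempty {B} {x = x} absorbs x∈xs with x ∈? B
  ... | yes x∈B = x , x∈B
  ... | no  x∉B = let u , u∈B , _ = absorbs x∈xs x∉B in u , u∈B

  -- Sizes up to which k vertices always suffice to absorb: 2^(k+1) - 2.
  capacity : ℕ → ℕ
  capacity zero    = 0
  capacity (suc k) = 2 + 2 * capacity k

  record AbsorbingSet (xs : List A) (k : ℕ) : Set where
    constructor absorbing
    field
      members  : List A
      members⊆ : members ⊆ xs
      size≤    : length members ≤ k
      absorbs  : members Absorbs xs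

  -- z absorbs its in-neighbours, so it only remains to absorb Out z xs.
  absorb-in-neighbours : ∀ {z xs B} → B Absorbs Out z xs → (z ∷ B) Absorbs xs
  absorb-in-neighbours {z} {xs} absorbs {x} x∈xs x∉z∷B with x ⇒? z
  ... | yes x⇒z = z , here refl , x⇒z
  ... | no ¬x⇒z = ⇒∃-mono there
        (absorbs (∈-filter⁺ (z ⇒?_) x∈xs (⇒-flip (x∉z∷B ∘ here) ¬x⇒z)) (x∉z∷B ∘ there))

  -- Greedy construction: a vertex z of low out-degree absorbs all its
  -- in-neighbours, and its at most capacity k out-neighbours are absorbed
  -- recursively.
  absorbing-set : ∀ k xs → Unique xs → length xs ≤ capacity k → AbsorbingSet xs k
  absorbing-set k       []           _    _     = absorbing [] (λ ()) z≤n (λ ())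
  absorbing-set (suc k) xs@(_ ∷ _) uniq bound =
    let z , z∈xs , low = low-outdegree xs uniq (s≤s z≤n)
        absorbing B B⊆ size absorbs =
          absorbing-set k (Out z xs) (filter⁺ (z ⇒?_) uniq) (halve low bound)
    in absorbing (z ∷ B) (∈-∷⁺ʳ z∈xs (⊆-trans B⊆ (filter-⊆ (z ⇒?_) xs)))
                 (s≤s size) (absorb-in-neighbours absorbs)
    where
      halve : ∀ {d m} → 2 * d < m → m ≤ 2 + 2 * capacity k → d ≤ capacity k
      halve {d} low bound = m<1+n⇒m≤n (*-cancelˡ-< 2 d (suc (capacity k))
        (<-≤-trans low (≤-trans bound (≤-reflexive (sym (*-suc 2 (capacity k)))))))

  ThreeCycle : A → A → A → Set
  ThreeCycle a b c = a ⇒ b × b ⇒ c × c ⇒ a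

  ThreeCycleIn : List A → Set
  ThreeCycleIn xs = ∃ λ a → ∃ λ b → ∃ λ c → a ∈ xs × b ∈ xs × c ∈ xs × ThreeCycle a b c

  CycleFree : List A → Set
  CycleFree xs = ∀ {a b c} → a ∈ xs → b ∈ xs → c ∈ xs → ¬ ThreeCycle a b c

  three-cycle? : ∀ a b c → Dec (ThreeCycle a b c)
  three-cycle? a b c = a ⇒? b ×-dec b ⇒? c ×-dec c ⇒? a

  find-three-cycle : ∀ xs → ThreeCycleIn xs ⊎ CycleFree xs
  find-three-cycle xs with any? (λ a → any? (λ b → any? (three-cycle? a b) xs) xs) xs
  ... | yes found = let a , a∈xs , found-b = find found
                        b , b∈xs , found-c = find found-b
                        c , c∈xs , cycle   = find found-c
                    in inj₁ (a , b , c , a∈xs , b∈xs , c∈xs , cycle)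
  ... | no  none  = inj₂ λ a∈xs b∈xs c∈xs cycle →
                      none (lose a∈xs (lose b∈xs (lose c∈xs cycle)))

  IsSource : List A → A → Set
  IsSource xs s = ∀ {w} → w ∈ xs → w ≢ s → s ⇒ w

  source : ∀ {x} xs → CycleFree xs → x ∈ xs → ∃ λ s → s ∈ xs × IsSource xs s
  source (x ∷ [])         _       _ = x , here refl , λ { (here refl) w≢x → contradiction refl w≢x }
  source (x ∷ xs@(_ ∷ _)) acyclic _ =
    let s , s∈xs , s-source =
          source xs (λ a∈ b∈ c∈ → acyclic (there a∈) (there b∈) (there c∈)) (here refl)
    in extend s∈xs s-source
    where
      -- Either the source s of xs survives, or x beats s and then, by
      -- cycle-freeness, everything that s beats.
      extend : ∀ {s} → s ∈ xs → IsSource xs s →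
               ∃ λ s′ → s′ ∈ x ∷ xs × IsSource (x ∷ xs) s′
      extend {s} s∈xs s-source with s ⇒? x | x ≟ s
      ... | yes s⇒x | _        = s , there s∈xs , λ { (here refl) _ → s⇒x
                                                     ; (there w∈xs) → s-source w∈xs }
      ... | no _     | yes refl = s , there s∈xs , λ { (here refl) w≢s → contradiction refl w≢s
                                                     ; (there w∈xs) → s-source w∈xs }
      ... | no ¬s⇒x | no x≢s   = x , here refl , x-source
        where
          x⇒s : x ⇒ s
          x⇒s = ⇒-flip (≢-sym x≢s) ¬s⇒x
          x-source : IsSource (x ∷ xs) x
          x-source (here refl)  w≢x = contradiction refl w≢x
          x-source {w} (there w∈xs) w≢x with w ≟ s | ⇒-total (≢-sym w≢x)
          ... | yes refl | _        = x⇒s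
          ... | no _     | inj₁ x⇒w = x⇒w
          ... | no w≢s   | inj₂ w⇒x =
            contradiction (x⇒s , s-source w∈xs w≢s , w⇒x)
                          (acyclic (here refl) (there s∈xs) (there w∈xs))

module TwinDomination {A : Set} (_≟_ : DecidableEquality A) (T : Tournament A) where

  open ListFacts
  open Removal _≟_
  open TournamentTheory _≟_ T
  open TournamentTheory _≟_ (converse T) using () renaming
    ( _⇒∃_ to _⇐∃_; _⇒∃?_ to _⇐∃?_; ⇒∃-mono to ⇐∃-mono
    ; _Absorbs_ to _Dominates_; Absorbs-mono to Dominates-mono
    ; absorb-except to dominate-except; absorbing-nonempty to dominating-nonempty
    ; AbsorbingSet to DominatingSet; absorbing to dominating; absorbing-set to dominating-set
    ; low-outdegree to low-indegree; IsSource to IsSink; source to sink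
    )

  TwinDominated : List A → A → Set
  TwinDominated S x = x ⇒∃ S × x ⇐∃ S

  _TwinDominates_ : List A → List A → Set
  S TwinDominates xs = ∀ {x} → x ∈ xs → x ∉ S → TwinDominated S x

  record TwinDominatingSet (xs : List A) (k : ℕ) : Set where
    constructor twin-dominating
    field
      members   : List A
      members⊆  : members ⊆ xs
      size≤     : length members ≤ k
      dominates : members TwinDominates xs

  weaken : ∀ {xs k k′} → k ≤ k′ → TwinDominatingSet xs k → TwinDominatingSet xs k′
  weaken k≤k′ (twin-dominating S S⊆ size dom) = twin-dominating S S⊆ (≤-trans size k≤k′) dom

  -- A member v of S is an out-neighbour of In v and an in-neighbour of Out v,
  -- so S only has to dominate the former and absorb the latter.
  twin-via-centre : ∀ {v S xs} → v ∈ S → S Dominates In v xs → S Absorbs Out v xs →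
                    S TwinDominates xs
  twin-via-centre {xs = xs} v∈S dominates absorbs x∈xs x∉S
    with neighbour x∈xs (λ { refl → x∉S v∈S })
  ... | inj₁ x∈In  = (_ , v∈S , ∈-In⁻ {xs = xs} x∈In .proj₂) , dominates x∈In x∉S
  ... | inj₂ x∈Out = absorbs x∈Out x∉S , (_ , v∈S , ∈-Out⁻ {xs = xs} x∈Out .proj₂)

  -- The splitting bound: v, a dominating set of its in-neighbours and an
  -- absorbing set of its out-neighbours.
  split-at : ∀ {v xs} a b → Unique xs → v ∈ xs →
             length (In v xs) ≤ capacity a → length (Out v xs) ≤ capacity b →
             TwinDominatingSet xs (suc (a + b))
  split-at {v} {xs} a b uniq v∈xs |In|≤ |Out|≤ = combine
    (dominating-set a (In v xs) (filter⁺ _ uniq) |In|≤)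
    (absorbing-set b (Out v xs) (filter⁺ _ uniq) |Out|≤)
    where
      combine : DominatingSet (In v xs) a → AbsorbingSet (Out v xs) b →
                TwinDominatingSet xs (suc (a + b))
      combine (dominating D D⊆ |D|≤ D-dominates) (absorbing B B⊆ |B|≤ B-absorbs) =
        twin-dominating (v ∷ D ++ B)
          (∈-∷⁺ʳ v∈xs (++-⊆ (⊆-trans D⊆ (filter-⊆ _ xs)) (⊆-trans B⊆ (filter-⊆ _ xs))))
          (s≤s (≤-trans (≤-reflexive (length-++ D)) (+-mono-≤ |D|≤ |B|≤)))
          (twin-via-centre (here refl) (Dominates-mono (there ∘ xs⊆xs++ys D B) D-dominates)
                                       (Absorbs-mono (there ∘ xs⊆ys++xs B D) B-absorbs))

  -- Eight vertices, v with exactly three in-neighbours I and four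
  -- out-neighbours O: here splitting at v costs 1 + 2 + 2, so the arcs
  -- between I and O have to be exploited.
  module EightWithInDegreeThree {xs} (uniq : Unique xs) {v} (v∈xs : v ∈ xs)
    (|I|≡3 : length (In v xs) ≡ 3) (|O|≡4 : length (Out v xs) ≡ 4) where

    I O : List A
    I = In v xs
    O = Out v xs

    I-unique : Unique I
    I-unique = filter⁺ _ uniq

    O-unique : Unique O
    O-unique = filter⁺ _ uniq

    I⊆xs : I ⊆ xs
    I⊆xs = filter-⊆ _ xs

    O⊆xs : O ⊆ xs
    O⊆xs = filter-⊆ _ xs

    I⇒v : ∀ {x} → x ∈ I → x ⇒ v
    I⇒v x∈I = ∈-In⁻ {xs = xs} x∈I .proj₂

    v⇒O : ∀ {x} → x ∈ O → v ⇒ x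
    v⇒O x∈O = ∈-Out⁻ {xs = xs} x∈O .proj₂

    I≢O : ∀ {x y} → x ∈ I → y ∈ O → x ≢ y
    I≢O x∈I y∈O refl = ⇒-asym (I⇒v x∈I) (v⇒O y∈O)

    locate : ∀ {x} → x ∈ xs → x ≡ v ⊎ x ∈ I ⊎ x ∈ O
    locate {x} x∈xs with x ≟ v
    ... | yes x≡v = inj₁ x≡v
    ... | no  x≢v = inj₂ (neighbour x∈xs x≢v)

    -- Removing any z from I leaves two vertices, one dominating the other.
    dominate-I-except : ∀ {z} → z ∈ I → DominatingSet (remove z I) 1
    dominate-I-except {z} z∈I = dominating-set 1 (remove z I) (remove-unique I-unique)
      (≤-reflexive (suc-injective (trans (length-remove I-unique z∈I) |I|≡3)))

    -- Case 1: no arc from O into I. Then all of v ∷ I beats all of O, and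
    -- it suffices to dominate v ∷ I and absorb O with two vertices each.
    without-back-arcs : (∀ {j o} → j ∈ v ∷ I → o ∈ O → j ⇒ o) → TwinDominatingSet xs 4
    without-back-arcs J⇒O = combine
      (dominating-set 2 (v ∷ I) (v∉I ∷ I-unique)
                      (≤-trans (≤-reflexive (cong suc |I|≡3)) (m≤m+n 4 2)))
      (absorbing-set 2 O O-unique (≤-trans (≤-reflexive |O|≡4) (m≤m+n 4 2)))
      where
        v∉I : All (v ≢_) I
        v∉I = All.tabulate (λ x∈I → ≢-sym (⇒-distinct (I⇒v x∈I)))

        combine : DominatingSet (v ∷ I) 2 → AbsorbingSet O 2 → TwinDominatingSet xs 4
        combine (dominating D D⊆ |D|≤ D-dominates) (absorbing B B⊆ |B|≤ B-absorbs) =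
          twin-dominating (D ++ B)
            (++-⊆ (⊆-trans D⊆ (∈-∷⁺ʳ v∈xs I⊆xs)) (⊆-trans B⊆ O⊆xs))
            (≤-trans (≤-reflexive (length-++ D)) (+-mono-≤ |D|≤ |B|≤))
            twin
          where
            d₀ : ∃ (_∈ D)
            d₀ = dominating-nonempty D-dominates (here refl)
            b₀ : ∃ (_∈ B)
            b₀ = absorbing-nonempty B-absorbs
                   (some-member (subst (0 <_) (sym |O|≡4) (s≤s z≤n)) .proj₂)
            twin-J : ∀ {x} → x ∈ v ∷ I → x ∉ D ++ B → TwinDominated (D ++ B) x
            twin-J x∈J x∉ = (b₀ .proj₁ , ∈-++⁺ʳ D (b₀ .proj₂) , J⇒O x∈J (B⊆ (b₀ .proj₂)))
                          , ⇐∃-mono ∈-++⁺ˡ (D-dominates x∈J (x∉ ∘ ∈-++⁺ˡ))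
            twin-O : ∀ {x} → x ∈ O → x ∉ D ++ B → TwinDominated (D ++ B) x
            twin-O x∈O x∉ = ⇒∃-mono (∈-++⁺ʳ D) (B-absorbs x∈O (x∉ ∘ ∈-++⁺ʳ D))
                          , (d₀ .proj₁ , ∈-++⁺ˡ (d₀ .proj₂) , J⇒O (D⊆ (d₀ .proj₂)) x∈O)
            twin : (D ++ B) TwinDominates xs
            twin x∈xs with locate x∈xs
            ... | inj₁ refl       = twin-J (here refl)
            ... | inj₂ (inj₁ x∈I) = twin-J (there x∈I)
            ... | inj₂ (inj₂ x∈O) = twin-O x∈O

    -- Case 2: b ∈ O beats z ∈ I and is beaten by u ∈ O. Then b together with
    -- one vertex dominating I ∖ z dominates I, and b together with one vertex
    -- absorbing its at most two out-neighbours in O absorbs O.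
    back-arc-from-beaten : ∀ {b z u} → b ∈ O → z ∈ I → b ⇒ z → u ∈ O → u ⇒ b →
                           TwinDominatingSet xs 4
    back-arc-from-beaten {b} {z} b∈O z∈I b⇒z u∈O u⇒b =
      combine (dominate-I-except z∈I) (absorbing-set 1 (Out b O) (filter⁺ _ O-unique) few-beaten)
      where
        few-beaten : length (Out b O) ≤ 2
        few-beaten = m<1+n⇒m≤n
          (subst (length (Out b O) <_) (suc-injective (trans (out+in O O-unique b∈O) |O|≡4))
                 (m<m+n _ (filter-some (_⇒? b) (lose u∈O u⇒b))))

        combine : DominatingSet (remove z I) 1 → AbsorbingSet (Out b O) 1 → TwinDominatingSet xs 4
        combine (dominating D D⊆ |D|≤ D-dominates) (absorbing B B⊆ |B|≤ B-absorbs) =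
          twin-dominating (v ∷ b ∷ D ++ B)
            (∈-∷⁺ʳ v∈xs (∈-∷⁺ʳ (O⊆xs b∈O)
              (++-⊆ (⊆-trans D⊆ (⊆-trans remove-⊆ I⊆xs))
                    (⊆-trans B⊆ (⊆-trans (filter-⊆ _ O) O⊆xs)))))
            (s≤s (s≤s (≤-trans (≤-reflexive (length-++ D)) (+-mono-≤ |D|≤ |B|≤))))
            (twin-via-centre (here refl)
              (Dominates-mono (there ∘ ∷⁺ʳ b (xs⊆xs++ys D B)) (dominate-except b⇒z D-dominates))
              (Absorbs-mono (there ∘ ∷⁺ʳ b (xs⊆ys++xs B D)) (absorb-in-neighbours B-absorbs)))

    -- Case 3: b ∈ O beats z ∈ I and all the rest of O, which is in turn beaten
    -- by all of I. Then b, one vertex dominating I ∖ z and two absorbing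
    -- O ∖ b suffice.
    back-arc-from-dominant : ∀ {b z} → b ∈ O → z ∈ I → b ⇒ z →
                             (∀ {o} → o ∈ O → o ≢ b → b ⇒ o) →
                             (∀ {i o} → i ∈ I → o ∈ Out b O → i ⇒ o) →
                             TwinDominatingSet xs 4
    back-arc-from-dominant {b} {z} b∈O z∈I b⇒z b⇒O I⇒Out-b = combine
      (dominate-I-except z∈I)
      (absorbing-set 2 (Out b O) (filter⁺ _ O-unique)
                     (≤-trans (length-filter _ O) (≤-trans (≤-reflexive |O|≡4) (m≤m+n 4 2))))
      where
        combine : DominatingSet (remove z I) 1 → AbsorbingSet (Out b O) 2 → TwinDominatingSet xs 4
        combine (dominating D D⊆ |D|≤ D-dominates) (absorbing C C⊆ |C|≤ C-absorbs) =
          twin-dominating (b ∷ D ++ C)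
            (∈-∷⁺ʳ (O⊆xs b∈O)
              (++-⊆ (⊆-trans D⊆ (⊆-trans remove-⊆ I⊆xs))
                    (⊆-trans C⊆ (⊆-trans (filter-⊆ _ O) O⊆xs))))
            (s≤s (≤-trans (≤-reflexive (length-++ D)) (+-mono-≤ |D|≤ |C|≤)))
            twin
          where
            d₀ : ∃ (_∈ D)
            d₀ = dominating-nonempty D-dominates
                   (another-member I-unique z∈I (subst (1 <_) (sym |I|≡3) (s≤s (s≤s z≤n))) .proj₂)
            c₀ : ∃ (_∈ C)
            c₀ = let o∈O , o≢b = ∈-remove⁻ (another-member O-unique b∈O
                                   (subst (1 <_) (sym |O|≡4) (s≤s (s≤s z≤n))) .proj₂)
                 in absorbing-nonempty C-absorbs (∈-filter⁺ (b ⇒?_) o∈O (b⇒O o∈O o≢b))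
            twin : (b ∷ D ++ C) TwinDominates xs
            twin x∈xs x∉S with locate x∈xs
            ... | inj₁ refl =
              (b , here refl , v⇒O b∈O) ,
              (d₀ .proj₁ , there (∈-++⁺ˡ (d₀ .proj₂)) , I⇒v (remove-⊆ (D⊆ (d₀ .proj₂))))
            ... | inj₂ (inj₁ x∈I) =
              (c₀ .proj₁ , there (∈-++⁺ʳ D (c₀ .proj₂)) , I⇒Out-b x∈I (C⊆ (c₀ .proj₂))) ,
              Dominates-mono (∷⁺ʳ b (xs⊆xs++ys D C)) (dominate-except b⇒z D-dominates) x∈I x∉S
            ... | inj₂ (inj₂ x∈O) =
              Absorbs-mono (∷⁺ʳ b (xs⊆ys++xs C D)) (absorb-in-neighbours C-absorbs) x∈O x∉S ,
              (b , here refl , b⇒O x∈O (x∉S ∘ here))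

    -- Case analysis on the arcs from O into I: if b ∈ O beats some z ∈ I,
    -- either b is beaten inside O (case 2), or some out-neighbour u of b in O
    -- beats a vertex of I (case 2 for u, which is beaten by b), or case 3.
    twin-dominating-set : TwinDominatingSet xs 4
    twin-dominating-set with any? (_⇒∃? I) O
    ... | no none = without-back-arcs J⇒O
      where
        J⇒O : ∀ {j o} → j ∈ v ∷ I → o ∈ O → j ⇒ o
        J⇒O (here refl) o∈O = v⇒O o∈O
        J⇒O (there j∈I) o∈O =
          ⇒-flip (≢-sym (I≢O j∈I o∈O)) (λ o⇒j → none (lose o∈O (_ , j∈I , o⇒j)))
    ... | yes some with find some
    ... | b , b∈O , z , z∈I , b⇒z with b ⇐∃? O
    ... | yes (u , u∈O , u⇒b) = back-arc-from-beaten b∈O z∈I b⇒z u∈O u⇒b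
    ... | no unbeaten with any? (_⇒∃? I) (Out b O)
    ... | yes some′ =
      let u , u∈Out-b , z′ , z′∈I , u⇒z′ = find some′
          u∈O , b⇒u = ∈-Out⁻ {xs = O} u∈Out-b
      in back-arc-from-beaten u∈O z′∈I u⇒z′ b∈O b⇒u
    ... | no none′ = back-arc-from-dominant b∈O z∈I b⇒z b⇒O I⇒Out-b
      where
        b⇒O : ∀ {o} → o ∈ O → o ≢ b → b ⇒ o
        b⇒O o∈O o≢b = ⇒-flip o≢b (λ o⇒b → unbeaten (_ , o∈O , o⇒b))
        I⇒Out-b : ∀ {i o} → i ∈ I → o ∈ Out b O → i ⇒ o
        I⇒Out-b i∈I o∈Out-b = ⇒-flip (≢-sym (I≢O i∈I (∈-Out⁻ {xs = O} o∈Out-b .proj₁)))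
                                     (λ o⇒i → none′ (lose o∈Out-b (_ , i∈I , o⇒i)))

  -- Eight vertices: split at a vertex v of in-degree i ≤ 3. For i ≤ 2 the
  -- splitting bound gives 1 + 0 + 3 or 1 + 1 + 2; i = 3 is the special case.
  eight : ∀ xs → Unique xs → length xs ≡ 8 → TwinDominatingSet xs 4
  eight xs uniq |xs|≡8 =
    let v , v∈xs , low = low-indegree xs uniq (subst (0 <_) (sym |xs|≡8) (s≤s z≤n))
    in by-indegree v∈xs (length (In v xs)) refl
         (trans (+-comm (length (In v xs)) _) (suc-injective (trans (out+in xs uniq v∈xs) |xs|≡8)))
         (subst (2 * length (In v xs) <_) |xs|≡8 low)
    where
      by-indegree : ∀ {v} → v ∈ xs → ∀ i → length (In v xs) ≡ i → i + length (Out v xs) ≡ 7 →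
                    2 * i < 8 → TwinDominatingSet xs 4
      by-indegree v∈xs 0 |I| |O| _ =
        split-at 0 3 uniq v∈xs (≤-reflexive |I|) (≤-trans (≤-reflexive |O|) (m≤m+n 7 7))
      by-indegree v∈xs 1 |I| |O| _ =
        split-at 1 2 uniq v∈xs (≤-trans (≤-reflexive |I|) (n≤1+n 1)) (≤-reflexive (suc-injective |O|))
      by-indegree v∈xs 2 |I| |O| _ =
        split-at 1 2 uniq v∈xs (≤-reflexive |I|)
                 (≤-trans (≤-reflexive (suc-injective (suc-injective |O|))) (n≤1+n 5))
      by-indegree v∈xs 3 |I| |O| _ =
        EightWithInDegreeThree.twin-dominating-set uniq v∈xs |I|
          (suc-injective (suc-injective (suc-injective |O|)))
      by-indegree v∈xs (suc (suc (suc (suc i)))) _ _ low =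
        contradiction low (≤⇒≯ (*-monoʳ-≤ 2 (m≤m+n 4 i)))

  add-vertex : ∀ {xs a b y S k} → y ∈ xs → S ⊆ remove b (remove a xs) → length S ≤ k →
    S TwinDominates remove b (remove a xs) →
    (a ∉ y ∷ S → TwinDominated (y ∷ S) a) → (b ∉ y ∷ S → TwinDominated (y ∷ S) b) →
    TwinDominatingSet xs (suc k)
  add-vertex {xs} {a} {b} {y} {S} y∈xs S⊆ |S|≤ S-dominates twin-a twin-b =
    twin-dominating (y ∷ S) (∈-∷⁺ʳ y∈xs (⊆-trans S⊆ (⊆-trans remove-⊆ remove-⊆)))
                    (s≤s |S|≤) twin
    where
      twin : (y ∷ S) TwinDominates xs
      twin {x} x∈xs x∉y∷S with x ≟ a | x ≟ b
      ... | yes refl | _        = twin-a x∉y∷S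
      ... | no _     | yes refl = twin-b x∉y∷S
      ... | no x≢a   | no x≢b   =
        let out , in′ = S-dominates (∈-remove⁺ (∈-remove⁺ x∈xs x≢a) x≢b) (x∉y∷S ∘ there)
        in ⇒∃-mono there out , ⇐∃-mono there in′

  -- Adding the vertices a, b of a directed triangle a ⇒ b ⇒ c ⇒ a to a
  -- twin dominated tournament costs one vertex of the triangle: b if some
  -- s ∈ S beats a, else a if b beats some s ∈ S, and c otherwise.
  extend-by-triangle : ∀ {xs a b c k} → a ∈ xs → b ∈ xs → c ∈ xs → ThreeCycle a b c →
    TwinDominatingSet (remove b (remove a xs)) k → TwinDominatingSet xs (suc k)
  extend-by-triangle {xs} {a} {b} {c} a∈xs b∈xs c∈xs (a⇒b , b⇒c , c⇒a)
                     (twin-dominating S S⊆ |S|≤ S-dominates) with a ⇐∃? S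
  ... | yes s⇒a = add-vertex b∈xs S⊆ |S|≤ S-dominates
                    (λ _ → (_ , here refl , a⇒b) , ⇐∃-mono there s⇒a)
                    (λ b∉ → contradiction (here refl) b∉)
  ... | no ¬s⇒a with b ⇒∃? S
  ... | yes b⇒s = add-vertex a∈xs S⊆ |S|≤ S-dominates
                    (λ a∉ → contradiction (here refl) a∉)
                    (λ _ → ⇒∃-mono there b⇒s , (_ , here refl , a⇒b))
  ... | no ¬b⇒s = add-vertex c∈xs S⊆ |S|≤ S-dominates
                    (λ _ → (s₀ , there s₀∈S , a⇒s₀) , (_ , here refl , c⇒a))
                    (λ _ → (_ , here refl , b⇒c) , (s₀ , there s₀∈S , s₀⇒b))
    where
      -- S is nonempty since it twin dominates c.
      c∈X′ : c ∈ remove b (remove a xs)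
      c∈X′ = ∈-remove⁺ (∈-remove⁺ c∈xs (⇒-distinct c⇒a)) (≢-sym (⇒-distinct b⇒c))
      s₀-exists : ∃ (_∈ S)
      s₀-exists = absorbing-nonempty (λ x∈ x∉ → S-dominates x∈ x∉ .proj₁) c∈X′
      s₀ : A
      s₀ = s₀-exists .proj₁
      s₀∈S : s₀ ∈ S
      s₀∈S = s₀-exists .proj₂
      s₀≢a : s₀ ≢ a
      s₀≢a = ∈-remove⁻ {xs = xs} (∈-remove⁻ {xs = remove a xs} (S⊆ s₀∈S) .proj₁) .proj₂
      s₀≢b : s₀ ≢ b
      s₀≢b = ∈-remove⁻ {xs = remove a xs} (S⊆ s₀∈S) .proj₂
      a⇒s₀ : a ⇒ s₀
      a⇒s₀ = ⇒-flip s₀≢a (λ s₀⇒a → ¬s⇒a (s₀ , s₀∈S , s₀⇒a))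
      s₀⇒b : s₀ ⇒ b
      s₀⇒b = ⇒-flip (≢-sym s₀≢b) (λ b⇒s₀ → ¬b⇒s (s₀ , s₀∈S , b⇒s₀))

  source-and-sink : ∀ {x xs} → CycleFree xs → x ∈ xs → TwinDominatingSet xs 2
  source-and-sink {xs = xs} acyclic x∈xs =
    let s , s∈xs , s-source = source xs acyclic x∈xs
        t , t∈xs , t-sink   = sink xs (λ a∈ b∈ c∈ (b⇒a , c⇒b , a⇒c) →
                                         acyclic a∈ c∈ b∈ (a⇒c , c⇒b , b⇒a)) x∈xs
    in twin-dominating (s ∷ t ∷ []) (∈-∷⁺ʳ s∈xs (∈-∷⁺ʳ t∈xs (λ ()))) ≤-refl
         λ y∈xs y∉ → (t , there (here refl) , t-sink y∈xs (y∉ ∘ there ∘ here))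
                    , (s , here refl , s-source y∈xs (y∉ ∘ here))

  -- Every tournament on 8 + 2j vertices is twin dominated by 4 + j of them:
  -- remove two vertices of a directed triangle, or use source and sink if
  -- there is none.
  twin-domination : ∀ j xs → Unique xs → length xs ≡ 8 + 2 * j → TwinDominatingSet xs (4 + j)
  twin-domination zero    xs uniq |xs| = eight xs uniq |xs|
  twin-domination (suc j) xs uniq |xs| with find-three-cycle xs
  ... | inj₂ acyclic =
    weaken (m≤m+n 2 _)
      (source-and-sink acyclic (some-member (subst (0 <_) (sym |xs|) (s≤s z≤n)) .proj₂))
  ... | inj₁ (a , b , c , a∈xs , b∈xs , c∈xs , cycle) =
    extend-by-triangle a∈xs b∈xs c∈xs cycle
      (twin-domination j (remove b (remove a xs)) (remove-unique (remove-unique uniq)) |X′|)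
    where
      b∈xs∖a : b ∈ remove a xs
      b∈xs∖a = ∈-remove⁺ b∈xs (≢-sym (⇒-distinct (cycle .proj₁)))
      |X′| : length (remove b (remove a xs)) ≡ 8 + 2 * j
      |X′| = suc-injective (suc-injective (begin
        suc (suc (length (remove b (remove a xs))))
          ≡⟨ cong suc (length-remove (remove-unique uniq) b∈xs∖a) ⟩
        suc (length (remove a xs))
          ≡⟨ length-remove uniq a∈xs ⟩
        length xs
          ≡⟨ |xs| ⟩
        8 + 2 * suc j
          ≡⟨ cong (8 +_) (*-suc 2 j) ⟩
        suc (suc (8 + 2 * j)) ∎))
        where open ≡-Reasoning

tournament : ∀ {n} {D : Digraph n} → IsTournament D → Tournament (Fin n)
tournament {D = D} tour = record
  { _⇒_     = λ u v → D u v ≡ true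
  ; _⇒?_    = λ u v → D u v Bool.≟ true
  ; ⇒-asym  = asym
  ; ⇒-total = total′
  }
  where
    open IsTournament tour
    asym : ∀ {u v} → D u v ≡ true → ¬ D v u ≡ true
    asym {u} {v} Duv Dvu with u Fin.≟ v
    ... | yes refl = contradiction (trans (sym Duv) (irreflexive u)) λ ()
    ... | no u≢v   = contradiction (trans (sym Dvu) (total u v u≢v Duv)) λ ()
    total′ : ∀ {u v} → u ≢ v → D u v ≡ true ⊎ D v u ≡ true
    total′ {u} {v} u≢v with D u v in Duv
    ... | true  = inj₁ refl
    ... | false = inj₂ (complete u v u≢v Duv)

∣p∪q∣≤∣p∣+∣q∣ : ∀ {m} (p q : Subset m) → ∣ p Sub.∪ q ∣ ≤ ∣ p ∣ + ∣ q ∣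
∣p∪q∣≤∣p∣+∣q∣ []          []          = z≤n
∣p∪q∣≤∣p∣+∣q∣ (true ∷ p)  (true ∷ q)  = s≤s (≤-trans (∣p∪q∣≤∣p∣+∣q∣ p q) (+-monoʳ-≤ ∣ p ∣ (n≤1+n ∣ q ∣)))
∣p∪q∣≤∣p∣+∣q∣ (true ∷ p)  (false ∷ q) = s≤s (∣p∪q∣≤∣p∣+∣q∣ p q)
∣p∪q∣≤∣p∣+∣q∣ (false ∷ p) (true ∷ q)  =
  ≤-trans (s≤s (∣p∪q∣≤∣p∣+∣q∣ p q)) (≤-reflexive (sym (+-suc ∣ p ∣ ∣ q ∣)))
∣p∪q∣≤∣p∣+∣q∣ (false ∷ p) (false ∷ q) = ∣p∪q∣≤∣p∣+∣q∣ p q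

toSubset : ∀ {n} → List (Fin n) → Subset n
toSubset []       = Sub.⊥
toSubset (x ∷ xs) = Sub.⁅ x ⁆ Sub.∪ toSubset xs

toSubset-∈ : ∀ {n x} (xs : List (Fin n)) → x ∈ xs → x Sub.∈ toSubset xs
toSubset-∈ (x ∷ xs) (here refl) = x∈p∪q⁺ (inj₁ (x∈⁅x⁆ x))
toSubset-∈ (x ∷ xs) (there x∈xs) = x∈p∪q⁺ (inj₂ (toSubset-∈ xs x∈xs))

∣toSubset∣≤length : ∀ {n} (xs : List (Fin n)) → ∣ toSubset xs ∣ ≤ length xs
∣toSubset∣≤length {n} []       = ≤-reflexive (∣⊥∣≡0 n)
∣toSubset∣≤length (x ∷ xs) = begin
  ∣ Sub.⁅ x ⁆ Sub.∪ toSubset xs ∣     ≤⟨ ∣p∪q∣≤∣p∣+∣q∣ Sub.⁅ x ⁆ (toSubset xs) ⟩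
  ∣ Sub.⁅ x ⁆ ∣ + ∣ toSubset xs ∣      ≡⟨ cong (_+ ∣ toSubset xs ∣) (∣⁅x⁆∣≡1 x) ⟩
  suc ∣ toSubset xs ∣                 ≤⟨ s≤s (∣toSubset∣≤length xs) ⟩
  suc (length xs)                     ∎
  where open ≤-Reasoning

orientations-twin-dominated : ∀ j → UpperOrientableTwinDomKn≤ (8 + 2 * j) (4 + j)
orientations-twin-dominated j D tour =
  convert (twin-domination j (allFin _) (allFin⁺ _) (length-tabulate id))
  where
    open TwinDomination Fin._≟_ (tournament tour)
    convert : ∀ {k} → TwinDominatingSet (allFin _) k → TwinDomNumber≤ D k
    convert (twin-dominating S _ |S|≤ S-dominates) =
      toSubset S , twin , ≤-trans (∣toSubset∣≤length S) |S|≤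
      where
        twin : IsTwinDominating D (toSubset S)
        twin v v∉S =
          let (u , u∈S , v⇒u) , (w , w∈S , w⇒v) = S-dominates (∈-allFin v) (v∉S ∘ toSubset-∈ S)
          in (u , toSubset-∈ S u∈S , v⇒u) , (w , toSubset-∈ S w∈S , w⇒v)

theorem3p1 : (n : ℕ) → 2 ∣ n → 8 ≤ n → UpperOrientableTwinDomKn≤ n (n / 2)
theorem3p1 n (divides q n≡q*2) 8≤n =
  subst₂ UpperOrientableTwinDomKn≤ (sym n≡8+2j) (sym n/2≡4+j) (orientations-twin-dominated j)
  where
    -- n = 2q with q ≥ 4, so n = 8 + 2j and n/2 = 4 + j for j = q - 4.
    j : ℕ
    j = q ∸ 4
    q≡4+j : q ≡ 4 + j
    q≡4+j = sym (m+[n∸m]≡n (*-cancelʳ-≤ 4 q 2 (subst (8 ≤_) n≡q*2 8≤n)))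
    n≡8+2j : n ≡ 8 + 2 * j
    n≡8+2j = trans n≡q*2 (trans (cong (_* 2) q≡4+j) (trans (*-comm (4 + j) 2) (*-distribˡ-+ 2 4 j)))
    n/2≡4+j : n / 2 ≡ 4 + j
    n/2≡4+j = trans (cong (_/ 2) n≡q*2) (trans (m*n/n≡m q 2) q≡4+j)
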